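{- For all terms $P,P'\in\widehat{\mathcal P}$: if $P\xrightarrow{\sigma}_2P'$, then there exists $P''\in\widehat{\mathcal P}$ with $P\xrightarrow{\sigma}_1P''$ and $P'\succeq^{+}P''$.
   Context: TACS. Fix a countable set $\Lambda$ of action names; $\overline{\Lambda}=\{\overline a : a\in\Lambda\}$ with $\overline{\overline a}=a$; $\mathcal A=\Lambda\cup\overline\Lambda\cup\{\tau\}$, and $a$ ranges over $\Lambda\cup\overline\Lambda$. Terms (set $\widehat{\mathcal P}$, possibly open) are generated by $P::=\mathbf 0\mid x\mid \alpha.P\mid \sigma.P\mid P+P\mid P|P\mid P\backslash L\mid P[f]\mid \mu x.P$, where $\alpha\in\mathcal A$, $x$ ranges over a countably infinite set of variables, $L\subseteq\mathcal A\setminus\{\tau\}$ is finite, and $f:\mathcal A\to\mathcal A$ satisfies $f(\tau)=\tau$, $f(\overline a)=\overline{f(a)}$ and $f(\alpha)\neq\alpha$ for only finitely many $\alpha$. $\mu x$ binds $x$; $P[Q/x]$ is substitution of $Q$ for the free occurrences of $x$. A variable is guarded in a term if each of its occurrences is in the scope of an action prefix $\alpha.\_$ (a $\sigma$-prefix does not count); in every term $\mu x.P$, $x$ must be guarded in $P$. $\overline L=\{\overline a: a\in L\}$. Urgent sets: $\mathcal U(\sigma.P)=\mathcal U(\mathbf 0)=\mathcal U(x)=\emptyset$, $\mathcal U(\alpha.P)=\{\alpha\}$, $\mathcal U(P+Q)=\mathcal U(P)\cup\mathcal U(Q)$, $\mathcal U(P|Q)=\mathcal U(P)\cup\mathcal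 U(Q)\cup\{\tau\mid \mathcal U(P)\cap\overline{\mathcal U(Q)}\neq\emptyset\}$, $\mathcal U(P\backslash L)=\mathcal U(P)\setminus(L\cup\overline L)$, $\mathcal U(P[f])=\{f(\alpha):\alpha\in\mathcal U(P)\}$, $\mathcal U(\mu x.P)=\mathcal U(P)$. Clock transitions $\xrightarrow{\sigma}_i$ ($i\in\{1,2\}$) on terms are the least relations with: $\mathbf 0\xrightarrow{\sigma}_i\mathbf 0$; $a.P\xrightarrow{\sigma}_i a.P$ for $a\in\Lambda\cup\overline\Lambda$; $\sigma.P\xrightarrow{\sigma}_iP$; if $P\xrightarrow{\sigma}_iP'$ then $\mu x.P\xrightarrow{\sigma}_iP'[\mu x.P/x]$, $P\backslash L\xrightarrow{\sigma}_iP'\backslash L$, $P[f]\xrightarrow{\sigma}_iP'[f]$; if $P\xrightarrow{\sigma}_iP'$ and $Q\xrightarrow{\sigma}_iQ'$ then $P+Q\xrightarrow{\sigma}_iP'+Q'$, and $P|Q\xrightarrow{\sigma}_iP'|Q'$ provided $\tau\notin\mathcal U(P|Q)$; and, only for $i=2$: if $P\xrightarrow{\sigma}_2P'$ then $\sigma.P\xrightarrow{\sigma}_2P'$. The syntactic relation $\succeq\subseteq\widehat{\mathcal P}\times\widehat{\mathcal P}$ is the smallest relation such that for all terms: $P\succeq P$; $P\succeq\sigma.P$; if $P'\succeq P$ and $Q'\succeq Q$ then $P'|Q'\succeq P|Q$ and $P'+Q'\succeq P+Q$; if $P'\succeq P$ then $P'\backslash L\succeq P\backslash L$ and $P'[f]\succeq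 P[f]$; if $P'\succeq P$ and $x$ is guarded in $P$ then $P'[\mu x.P/x]\succeq\mu x.P$. $\succeq^{+}$ denotes the transitive closure of $\succeq$. -}

module Defs where

open import Data.Nat using (ℕ; zero; suc)
open import Data.List using (List)
open import Data.List.Membership.Propositional using (_∈_; _∉_)
open import Data.Product using (Σ; _×_; ∃)
open import Data.Unit using (⊤)
open import Relation.Nullary using (¬_)
open import Relation.Binary.PropositionalEquality using (_≡_; _≢_)
open import Relation.Binary.Construct.Closure.Transitive using (TransClosure)

module CCS (Λ : Set) where

  data Vis : Set where
    nm : Λ → Vis
    co : Λ → Vis

  bar : Vis → Vis
  bar (nm a) = co a
  bar (co a) = nm a

  data Act : Set where
    τ   : Act
    vis : Vis → Act

  record Relabel : Set where
    field
      fun     : Vis → Vis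
      fun-bar : ∀ a → fun (bar a) ≡ bar (fun a)
      finite  : Σ (List Vis) λ S → ∀ a → a ∉ S → fun a ≡ a

  applyR : Relabel → Act → Act
  applyR f τ       = τ
  applyR f (vis a) = vis (Relabel.fun f a)

  -- terms, variables as de Bruijn indices; μ binds index 0.
  -- Restriction sets L ⊆ 𝒜∖{τ} are finite lists of visible actions.
  data Term : Set where
    𝟎    : Term
    var  : ℕ → Term
    _∙_  : Act → Term → Term
    σ∙_  : Term → Term
    _⊕_  : Term → Term → Term
    _∥_  : Term → Term → Term
    _∖_  : Term → List Vis → Term
    _⟦_⟧ : Term → Relabel → Term
    μ    : Term → Term

  ext : (ℕ → ℕ) → ℕ → ℕ
  ext ρ zero    = zero
  ext ρ (suc n) = suc (ρ n)

  rename : (ℕ → ℕ) → Term → Term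
  rename ρ 𝟎         = 𝟎
  rename ρ (var n)   = var (ρ n)
  rename ρ (α ∙ P)   = α ∙ rename ρ P
  rename ρ (σ∙ P)    = σ∙ rename ρ P
  rename ρ (P ⊕ Q)   = rename ρ P ⊕ rename ρ Q
  rename ρ (P ∥ Q)   = rename ρ P ∥ rename ρ Q
  rename ρ (P ∖ L)   = rename ρ P ∖ L
  rename ρ (P ⟦ f ⟧) = rename ρ P ⟦ f ⟧
  rename ρ (μ P)     = μ (rename (ext ρ) P)

  exts : (ℕ → Term) → ℕ → Term
  exts s zero    = var zero
  exts s (suc n) = rename suc (s n)

  subst : (ℕ → Term) → Term → Term
  subst s 𝟎         = 𝟎
  subst s (var n)   = s n
  subst s (α ∙ P)   = α ∙ subst s P
  subst s (σ∙ P)    = σ∙ subst s P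
  subst s (P ⊕ Q)   = subst s P ⊕ subst s Q
  subst s (P ∥ Q)   = subst s P ∥ subst s Q
  subst s (P ∖ L)   = subst s P ∖ L
  subst s (P ⟦ f ⟧) = subst s P ⟦ f ⟧
  subst s (μ P)     = μ (subst (exts s) P)

  sub0 : Term → ℕ → Term
  sub0 Q zero    = Q
  sub0 Q (suc n) = var n

  -- P [ Q / x ] where x is the variable bound by the enclosing μ (index 0)
  _[_/0] : Term → Term → Term
  P [ Q /0] = subst (sub0 Q) P

  data Guarded : ℕ → Term → Set where
    g-𝟎   : ∀ {n} → Guarded n 𝟎
    g-var : ∀ {n m} → m ≢ n → Guarded n (var m)
    g-act : ∀ {n α P} → Guarded n (α ∙ P)
    g-σ   : ∀ {n P} → Guarded n P → Guarded n (σ∙ P)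
    g-⊕   : ∀ {n P Q} → Guarded n P → Guarded n Q → Guarded n (P ⊕ Q)
    g-∥   : ∀ {n P Q} → Guarded n P → Guarded n Q → Guarded n (P ∥ Q)
    g-∖   : ∀ {n P L} → Guarded n P → Guarded n (P ∖ L)
    g-⟦⟧  : ∀ {n P f} → Guarded n P → Guarded n (P ⟦ f ⟧)
    g-μ   : ∀ {n P} → Guarded (suc n) P → Guarded n (μ P)

  -- well-formed terms (the set 𝒫̂): in every μx.P, x is guarded in P
  data WF : Term → Set where
    wf-𝟎   : WF 𝟎
    wf-var : ∀ {n} → WF (var n)
    wf-act : ∀ {α P} → WF P → WF (α ∙ P)
    wf-σ   : ∀ {P} → WF P → WF (σ∙ P)
    wf-⊕   : ∀ {P Q} → WF P → WF Q → WF (P ⊕ Q)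
    wf-∥   : ∀ {P Q} → WF P → WF Q → WF (P ∥ Q)
    wf-∖   : ∀ {P L} → WF P → WF (P ∖ L)
    wf-⟦⟧  : ∀ {P f} → WF P → WF (P ⟦ f ⟧)
    wf-μ   : ∀ {P} → Guarded zero P → WF P → WF (μ P)

  NotRestricted : Act → List Vis → Set
  NotRestricted τ       L = ⊤
  NotRestricted (vis a) L = a ∉ L × bar a ∉ L

  data _∈U_ : Act → Term → Set where
    u-act : ∀ {α P} → α ∈U (α ∙ P)
    u-⊕ˡ  : ∀ {α P Q} → α ∈U P → α ∈U (P ⊕ Q)
    u-⊕ʳ  : ∀ {α P Q} → α ∈U Q → α ∈U (P ⊕ Q)
    u-∥ˡ  : ∀ {α P Q} → α ∈U P → α ∈U (P ∥ Q)
    u-∥ʳ  : ∀ {α P Q} → α ∈U Q → α ∈U (P ∥ Q)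
    u-∥τ  : ∀ {P Q} a → vis a ∈U P → vis (bar a) ∈U Q → τ ∈U (P ∥ Q)
    u-∖   : ∀ {α P L} → α ∈U P → NotRestricted α L → α ∈U (P ∖ L)
    u-⟦⟧  : ∀ {α P f} → α ∈U P → applyR f α ∈U (P ⟦ f ⟧)
    u-μ   : ∀ {α P} → α ∈U P → α ∈U (μ P)

  data Mode : Set where
    one two : Mode

  data _—σ[_]→_ : Term → Mode → Term → Set where
    c-𝟎   : ∀ {i} → 𝟎 —σ[ i ]→ 𝟎
    c-act : ∀ {i a P} → (vis a ∙ P) —σ[ i ]→ (vis a ∙ P)
    c-σ   : ∀ {i P} → (σ∙ P) —σ[ i ]→ P
    c-μ   : ∀ {i P P'} → P —σ[ i ]→ P' → μ P —σ[ i ]→ (P' [ μ P /0])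
    c-∖   : ∀ {i P P' L} → P —σ[ i ]→ P' → (P ∖ L) —σ[ i ]→ (P' ∖ L)
    c-⟦⟧  : ∀ {i P P' f} → P —σ[ i ]→ P' → (P ⟦ f ⟧) —σ[ i ]→ (P' ⟦ f ⟧)
    c-⊕   : ∀ {i P P' Q Q'} → P —σ[ i ]→ P' → Q —σ[ i ]→ Q' →
            (P ⊕ Q) —σ[ i ]→ (P' ⊕ Q')
    c-∥   : ∀ {i P P' Q Q'} → P —σ[ i ]→ P' → Q —σ[ i ]→ Q' →
            ¬ (τ ∈U (P ∥ Q)) → (P ∥ Q) —σ[ i ]→ (P' ∥ Q')
    c-σσ  : ∀ {P P'} → P —σ[ two ]→ P' → (σ∙ P) —σ[ two ]→ P'

  data _⪰_ : Term → Term → Set where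
    ⪰-refl : ∀ {P} → P ⪰ P
    ⪰-σ    : ∀ {P} → P ⪰ (σ∙ P)
    ⪰-∥    : ∀ {P P' Q Q'} → P' ⪰ P → Q' ⪰ Q → (P' ∥ Q') ⪰ (P ∥ Q)
    ⪰-⊕    : ∀ {P P' Q Q'} → P' ⪰ P → Q' ⪰ Q → (P' ⊕ Q') ⪰ (P ⊕ Q)
    ⪰-∖    : ∀ {P P' L} → P' ⪰ P → (P' ∖ L) ⪰ (P ∖ L)
    ⪰-⟦⟧   : ∀ {P P' f} → P' ⪰ P → (P' ⟦ f ⟧) ⪰ (P ⟦ f ⟧)
    ⪰-μ    : ∀ {P P'} → P' ⪰ P → Guarded zero P → (P' [ μ P /0]) ⪰ μ P

  _⪰⁺_ : Term → Term → Set
  _⪰⁺_ = TransClosure _⪰_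

-- Every rule of →σ₂ except σ-skipping
-- (σ.P →σ₂ P′ from P →σ₂ P′) is also a rule of →σ₁, and ⪰⁺ is a congruence that is
-- stable under substitution, so those cases go through by the induction hypothesis.
-- For σ-skipping take σ.P →σ₁ P: the induction hypothesis gives P →σ₁ P₁ with
-- P′ ⪰⁺ P₁, and every σ₁-step of a well-formed term moves up along ⪰, so P₁ ⪰ P.
module Submission where

open import Defs
open import Data.Nat using (ℕ; zero; suc)
open import Data.Nat.Properties using (suc-injective)
open import Data.Product using (Σ; _×_; _,_)
open import Data.Empty using (⊥-elim)
open import Function.Base using (_∘_)
open import Function.Bundles using (_↣_)
open import Relation.Binary.PropositionalEquality using (_≡_; _≢_; refl; cong; cong₂; sym; trans)
open import Relation.Binary.Construct.Closure.Transitive using ([_]; _∷_; _++_; _∷ʳ_)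

module _ {Λ : Set} where
  open CCS Λ

  ext-cong : ∀ {ρ ρ′} → (∀ n → ρ n ≡ ρ′ n) → ∀ n → ext ρ n ≡ ext ρ′ n
  ext-cong h zero    = refl
  ext-cong h (suc n) = cong suc (h n)

  rename-cong : ∀ {ρ ρ′} → (∀ n → ρ n ≡ ρ′ n) → ∀ T → rename ρ T ≡ rename ρ′ T
  rename-cong h 𝟎         = refl
  rename-cong h (var n)   = cong var (h n)
  rename-cong h (α ∙ P)   = cong (α ∙_) (rename-cong h P)
  rename-cong h (σ∙ P)    = cong σ∙_ (rename-cong h P)
  rename-cong h (P ⊕ Q)   = cong₂ _⊕_ (rename-cong h P) (rename-cong h Q)
  rename-cong h (P ∥ Q)   = cong₂ _∥_ (rename-cong h P) (rename-cong h Q)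
  rename-cong h (P ∖ L)   = cong (_∖ L) (rename-cong h P)
  rename-cong h (P ⟦ f ⟧) = cong (_⟦ f ⟧) (rename-cong h P)
  rename-cong h (μ P)     = cong μ (rename-cong (ext-cong h) P)

  exts-cong : ∀ {s s′} → (∀ n → s n ≡ s′ n) → ∀ n → exts s n ≡ exts s′ n
  exts-cong h zero    = refl
  exts-cong h (suc n) = cong (rename suc) (h n)

  subst-cong : ∀ {s s′} → (∀ n → s n ≡ s′ n) → ∀ T → subst s T ≡ subst s′ T
  subst-cong h 𝟎         = refl
  subst-cong h (var n)   = h n
  subst-cong h (α ∙ P)   = cong (α ∙_) (subst-cong h P)
  subst-cong h (σ∙ P)    = cong σ∙_ (subst-cong h P)
  subst-cong h (P ⊕ Q)   = cong₂ _⊕_ (subst-cong h P) (subst-cong h Q)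
  subst-cong h (P ∥ Q)   = cong₂ _∥_ (subst-cong h P) (subst-cong h Q)
  subst-cong h (P ∖ L)   = cong (_∖ L) (subst-cong h P)
  subst-cong h (P ⟦ f ⟧) = cong (_⟦ f ⟧) (subst-cong h P)
  subst-cong h (μ P)     = cong μ (subst-cong (exts-cong h) P)

  rename-rename : ∀ ρ ρ′ T → rename ρ (rename ρ′ T) ≡ rename (ρ ∘ ρ′) T
  rename-rename ρ ρ′ 𝟎         = refl
  rename-rename ρ ρ′ (var n)   = refl
  rename-rename ρ ρ′ (α ∙ P)   = cong (α ∙_) (rename-rename ρ ρ′ P)
  rename-rename ρ ρ′ (σ∙ P)    = cong σ∙_ (rename-rename ρ ρ′ P)
  rename-rename ρ ρ′ (P ⊕ Q)   = cong₂ _⊕_ (rename-rename ρ ρ′ P) (rename-rename ρ ρ′ Q)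
  rename-rename ρ ρ′ (P ∥ Q)   = cong₂ _∥_ (rename-rename ρ ρ′ P) (rename-rename ρ ρ′ Q)
  rename-rename ρ ρ′ (P ∖ L)   = cong (_∖ L) (rename-rename ρ ρ′ P)
  rename-rename ρ ρ′ (P ⟦ f ⟧) = cong (_⟦ f ⟧) (rename-rename ρ ρ′ P)
  rename-rename ρ ρ′ (μ P)     =
    cong μ (trans (rename-rename (ext ρ) (ext ρ′) P) (rename-cong ext-∘ P))
    where
    ext-∘ : ∀ n → ext ρ (ext ρ′ n) ≡ ext (ρ ∘ ρ′) n
    ext-∘ zero    = refl
    ext-∘ (suc n) = refl

  subst-rename : ∀ s ρ T → subst s (rename ρ T) ≡ subst (s ∘ ρ) T
  subst-rename s ρ 𝟎         = refl
  subst-rename s ρ (var n)   = refl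
  subst-rename s ρ (α ∙ P)   = cong (α ∙_) (subst-rename s ρ P)
  subst-rename s ρ (σ∙ P)    = cong σ∙_ (subst-rename s ρ P)
  subst-rename s ρ (P ⊕ Q)   = cong₂ _⊕_ (subst-rename s ρ P) (subst-rename s ρ Q)
  subst-rename s ρ (P ∥ Q)   = cong₂ _∥_ (subst-rename s ρ P) (subst-rename s ρ Q)
  subst-rename s ρ (P ∖ L)   = cong (_∖ L) (subst-rename s ρ P)
  subst-rename s ρ (P ⟦ f ⟧) = cong (_⟦ f ⟧) (subst-rename s ρ P)
  subst-rename s ρ (μ P)     =
    cong μ (trans (subst-rename (exts s) (ext ρ) P) (subst-cong exts-∘-ext P))
    where
    exts-∘-ext : ∀ n → exts s (ext ρ n) ≡ exts (s ∘ ρ) n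
    exts-∘-ext zero    = refl
    exts-∘-ext (suc n) = refl

  rename-subst : ∀ ρ s T → rename ρ (subst s T) ≡ subst (rename ρ ∘ s) T
  rename-subst ρ s 𝟎         = refl
  rename-subst ρ s (var n)   = refl
  rename-subst ρ s (α ∙ P)   = cong (α ∙_) (rename-subst ρ s P)
  rename-subst ρ s (σ∙ P)    = cong σ∙_ (rename-subst ρ s P)
  rename-subst ρ s (P ⊕ Q)   = cong₂ _⊕_ (rename-subst ρ s P) (rename-subst ρ s Q)
  rename-subst ρ s (P ∥ Q)   = cong₂ _∥_ (rename-subst ρ s P) (rename-subst ρ s Q)
  rename-subst ρ s (P ∖ L)   = cong (_∖ L) (rename-subst ρ s P)
  rename-subst ρ s (P ⟦ f ⟧) = cong (_⟦ f ⟧) (rename-subst ρ s P)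
  rename-subst ρ s (μ P)     =
    cong μ (trans (rename-subst (ext ρ) (exts s) P) (subst-cong rename-exts P))
    where
    rename-exts : ∀ n → rename (ext ρ) (exts s n) ≡ exts (rename ρ ∘ s) n
    rename-exts zero    = refl
    rename-exts (suc n) =
      trans (rename-rename (ext ρ) suc (s n)) (sym (rename-rename suc ρ (s n)))

  subst-subst : ∀ s s′ T → subst s (subst s′ T) ≡ subst (subst s ∘ s′) T
  subst-subst s s′ 𝟎         = refl
  subst-subst s s′ (var n)   = refl
  subst-subst s s′ (α ∙ P)   = cong (α ∙_) (subst-subst s s′ P)
  subst-subst s s′ (σ∙ P)    = cong σ∙_ (subst-subst s s′ P)
  subst-subst s s′ (P ⊕ Q)   = cong₂ _⊕_ (subst-subst s s′ P) (subst-subst s s′ Q)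
  subst-subst s s′ (P ∥ Q)   = cong₂ _∥_ (subst-subst s s′ P) (subst-subst s s′ Q)
  subst-subst s s′ (P ∖ L)   = cong (_∖ L) (subst-subst s s′ P)
  subst-subst s s′ (P ⟦ f ⟧) = cong (_⟦ f ⟧) (subst-subst s s′ P)
  subst-subst s s′ (μ P)     =
    cong μ (trans (subst-subst (exts s) (exts s′) P) (subst-cong subst-exts P))
    where
    subst-exts : ∀ n → subst (exts s) (exts s′ n) ≡ exts (subst s ∘ s′) n
    subst-exts zero    = refl
    subst-exts (suc n) =
      trans (subst-rename (exts s) suc (s′ n)) (sym (rename-subst suc s (s′ n)))

  subst-var : ∀ {s} → (∀ n → s n ≡ var n) → ∀ T → subst s T ≡ T
  subst-var h 𝟎         = refl
  subst-var h (var n)   = h n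
  subst-var h (α ∙ P)   = cong (α ∙_) (subst-var h P)
  subst-var h (σ∙ P)    = cong σ∙_ (subst-var h P)
  subst-var h (P ⊕ Q)   = cong₂ _⊕_ (subst-var h P) (subst-var h Q)
  subst-var h (P ∥ Q)   = cong₂ _∥_ (subst-var h P) (subst-var h Q)
  subst-var h (P ∖ L)   = cong (_∖ L) (subst-var h P)
  subst-var h (P ⟦ f ⟧) = cong (_⟦ f ⟧) (subst-var h P)
  subst-var {s} h (μ P) = cong μ (subst-var exts-var P)
    where
    exts-var : ∀ n → exts s n ≡ var n
    exts-var zero    = refl
    exts-var (suc n) = cong (rename suc) (h n)

  subst-[/0] : ∀ s A R → subst s (A [ R /0]) ≡ (subst (exts s) A) [ subst s R /0]
  subst-[/0] s A R = trans (subst-subst s (sub0 R) A)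
    (trans (subst-cong commute A) (sym (subst-subst (sub0 (subst s R)) (exts s) A)))
    where
    commute : ∀ n → subst s (sub0 R n) ≡ subst (sub0 (subst s R)) (exts s n)
    commute zero    = refl
    commute (suc m) =
      sym (trans (subst-rename (sub0 (subst s R)) suc (s m)) (subst-var (λ _ → refl) (s m)))

  Guarded-rename-avoiding : ∀ {j ρ} → (∀ m → ρ m ≢ j) → ∀ T → Guarded j (rename ρ T)
  Guarded-rename-avoiding h 𝟎         = g-𝟎
  Guarded-rename-avoiding h (var n)   = g-var (h n)
  Guarded-rename-avoiding h (α ∙ P)   = g-act
  Guarded-rename-avoiding h (σ∙ P)    = g-σ (Guarded-rename-avoiding h P)
  Guarded-rename-avoiding h (P ⊕ Q)   =
    g-⊕ (Guarded-rename-avoiding h P) (Guarded-rename-avoiding h Q)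
  Guarded-rename-avoiding h (P ∥ Q)   =
    g-∥ (Guarded-rename-avoiding h P) (Guarded-rename-avoiding h Q)
  Guarded-rename-avoiding h (P ∖ L)   = g-∖ (Guarded-rename-avoiding h P)
  Guarded-rename-avoiding h (P ⟦ f ⟧) = g-⟦⟧ (Guarded-rename-avoiding h P)
  Guarded-rename-avoiding {j} {ρ} h (μ P) = g-μ (Guarded-rename-avoiding ext-avoids P)
    where
    ext-avoids : ∀ m → ext ρ m ≢ suc j
    ext-avoids zero    ()
    ext-avoids (suc m) e = h m (suc-injective e)

  Guarded-rename : ∀ {k j ρ T} → (∀ m → ρ m ≡ j → m ≡ k) →
                   Guarded k T → Guarded j (rename ρ T)
  Guarded-rename h g-𝟎               = g-𝟎
  Guarded-rename h (g-var {m = m} m≢k) = g-var (m≢k ∘ h m)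
  Guarded-rename h g-act             = g-act
  Guarded-rename h (g-σ g)           = g-σ (Guarded-rename h g)
  Guarded-rename h (g-⊕ g g′)        = g-⊕ (Guarded-rename h g) (Guarded-rename h g′)
  Guarded-rename h (g-∥ g g′)        = g-∥ (Guarded-rename h g) (Guarded-rename h g′)
  Guarded-rename h (g-∖ g)           = g-∖ (Guarded-rename h g)
  Guarded-rename h (g-⟦⟧ g)          = g-⟦⟧ (Guarded-rename h g)
  Guarded-rename {k} {j} {ρ} h (g-μ g) = g-μ (Guarded-rename ext-preimage g)
    where
    ext-preimage : ∀ m → ext ρ m ≡ suc j → m ≡ suc k
    ext-preimage zero    ()
    ext-preimage (suc m) e = cong suc (h m (suc-injective e))

  Guarded-subst : ∀ {k j s T} → (∀ m → m ≢ k → Guarded j (s m)) →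
                  Guarded k T → Guarded j (subst s T)
  Guarded-subst h g-𝟎                 = g-𝟎
  Guarded-subst h (g-var {m = m} m≢k) = h m m≢k
  Guarded-subst h g-act               = g-act
  Guarded-subst h (g-σ g)             = g-σ (Guarded-subst h g)
  Guarded-subst h (g-⊕ g g′)          = g-⊕ (Guarded-subst h g) (Guarded-subst h g′)
  Guarded-subst h (g-∥ g g′)          = g-∥ (Guarded-subst h g) (Guarded-subst h g′)
  Guarded-subst h (g-∖ g)             = g-∖ (Guarded-subst h g)
  Guarded-subst h (g-⟦⟧ g)            = g-⟦⟧ (Guarded-subst h g)
  Guarded-subst {k} {j} {s} h (g-μ g) = g-μ (Guarded-subst exts-guarded g)
    where
    exts-guarded : ∀ m → m ≢ suc k → Guarded (suc j) (exts s m)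
    exts-guarded zero    _   = g-var (λ ())
    exts-guarded (suc m) m≢k =
      Guarded-rename (λ _ → suc-injective) (h m (m≢k ∘ cong suc))

  Guarded-exts : ∀ s m → m ≢ zero → Guarded zero (exts s m)
  Guarded-exts s zero    0≢0 = ⊥-elim (0≢0 refl)
  Guarded-exts s (suc m) _   = Guarded-rename-avoiding (λ _ ()) (s m)

  WF-rename : ∀ ρ {T} → WF T → WF (rename ρ T)
  WF-rename ρ wf-𝟎        = wf-𝟎
  WF-rename ρ wf-var      = wf-var
  WF-rename ρ (wf-act w)  = wf-act (WF-rename ρ w)
  WF-rename ρ (wf-σ w)    = wf-σ (WF-rename ρ w)
  WF-rename ρ (wf-⊕ w w′) = wf-⊕ (WF-rename ρ w) (WF-rename ρ w′)
  WF-rename ρ (wf-∥ w w′) = wf-∥ (WF-rename ρ w) (WF-rename ρ w′)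
  WF-rename ρ (wf-∖ w)    = wf-∖ (WF-rename ρ w)
  WF-rename ρ (wf-⟦⟧ w)   = wf-⟦⟧ (WF-rename ρ w)
  WF-rename ρ (wf-μ g w)  = wf-μ (Guarded-rename ext-preimage g) (WF-rename (ext ρ) w)
    where
    ext-preimage : ∀ m → ext ρ m ≡ zero → m ≡ zero
    ext-preimage zero    _ = refl
    ext-preimage (suc m) ()

  WF-subst : ∀ {s T} → (∀ n → WF (s n)) → WF T → WF (subst s T)
  WF-subst h wf-𝟎          = wf-𝟎
  WF-subst h (wf-var {n})  = h n
  WF-subst h (wf-act w)    = wf-act (WF-subst h w)
  WF-subst h (wf-σ w)      = wf-σ (WF-subst h w)
  WF-subst h (wf-⊕ w w′)   = wf-⊕ (WF-subst h w) (WF-subst h w′)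
  WF-subst h (wf-∥ w w′)   = wf-∥ (WF-subst h w) (WF-subst h w′)
  WF-subst h (wf-∖ w)      = wf-∖ (WF-subst h w)
  WF-subst h (wf-⟦⟧ w)     = wf-⟦⟧ (WF-subst h w)
  WF-subst {s} h (wf-μ g w) = wf-μ (Guarded-subst (Guarded-exts s) g) (WF-subst WF-exts w)
    where
    WF-exts : ∀ n → WF (exts s n)
    WF-exts zero    = wf-var
    WF-exts (suc n) = WF-rename suc (h n)

  WF-[/0] : ∀ {P R} → WF P → WF R → WF (P [ R /0])
  WF-[/0] {R = R} wP wR = WF-subst WF-sub0 wP
    where
    WF-sub0 : ∀ n → WF (sub0 R n)
    WF-sub0 zero    = wR
    WF-sub0 (suc n) = wf-var

  WF-clock : ∀ {i P P′} → WF P → P —σ[ i ]→ P′ → WF P′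
  WF-clock w          c-𝟎            = w
  WF-clock w          c-act          = w
  WF-clock (wf-σ w)   c-σ            = w
  WF-clock (wf-μ g w) (c-μ c)        = WF-[/0] (WF-clock w c) (wf-μ g w)
  WF-clock (wf-∖ w)   (c-∖ c)        = wf-∖ (WF-clock w c)
  WF-clock (wf-⟦⟧ w)  (c-⟦⟧ c)       = wf-⟦⟧ (WF-clock w c)
  WF-clock (wf-⊕ w v) (c-⊕ c d)      = wf-⊕ (WF-clock w c) (WF-clock v d)
  WF-clock (wf-∥ w v) (c-∥ c d _)    = wf-∥ (WF-clock w c) (WF-clock v d)
  WF-clock (wf-σ w)   (c-σσ c)       = WF-clock w c

  ⪰-subst : ∀ s {P′ P} → P′ ⪰ P → subst s P′ ⪰ subst s P
  ⪰-subst s ⪰-refl      = ⪰-refl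
  ⪰-subst s ⪰-σ         = ⪰-σ
  ⪰-subst s (⪰-∥ p q)   = ⪰-∥ (⪰-subst s p) (⪰-subst s q)
  ⪰-subst s (⪰-⊕ p q)   = ⪰-⊕ (⪰-subst s p) (⪰-subst s q)
  ⪰-subst s (⪰-∖ p)     = ⪰-∖ (⪰-subst s p)
  ⪰-subst s (⪰-⟦⟧ p)    = ⪰-⟦⟧ (⪰-subst s p)
  ⪰-subst s (⪰-μ {P} {P′} p g) rewrite subst-[/0] s P′ (μ P) =
    ⪰-μ (⪰-subst (exts s) p) (Guarded-subst (Guarded-exts s) g)

  ⪰⁺-map : ∀ (F : Term → Term) → (∀ {P′ P} → P′ ⪰ P → F P′ ⪰ F P) →
           ∀ {P′ P} → P′ ⪰⁺ P → F P′ ⪰⁺ F P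
  ⪰⁺-map F F-mono [ p ]   = [ F-mono p ]
  ⪰⁺-map F F-mono (p ∷ r) = F-mono p ∷ ⪰⁺-map F F-mono r

  ⪰⁺-subst : ∀ s {P′ P} → P′ ⪰⁺ P → subst s P′ ⪰⁺ subst s P
  ⪰⁺-subst s = ⪰⁺-map (subst s) (⪰-subst s)

  ⪰⁺-∖ : ∀ {P′ P} L → P′ ⪰⁺ P → (P′ ∖ L) ⪰⁺ (P ∖ L)
  ⪰⁺-∖ L = ⪰⁺-map (_∖ L) ⪰-∖

  ⪰⁺-⟦⟧ : ∀ {P′ P} f → P′ ⪰⁺ P → (P′ ⟦ f ⟧) ⪰⁺ (P ⟦ f ⟧)
  ⪰⁺-⟦⟧ f = ⪰⁺-map (_⟦ f ⟧) ⪰-⟦⟧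

  ⪰⁺-⊕ : ∀ {P′ P Q′ Q} → P′ ⪰⁺ P → Q′ ⪰⁺ Q → (P′ ⊕ Q′) ⪰⁺ (P ⊕ Q)
  ⪰⁺-⊕ {P = P} {Q′ = Q′} p q =
    ⪰⁺-map (_⊕ Q′) (λ r → ⪰-⊕ r ⪰-refl) p ++ ⪰⁺-map (P ⊕_) (⪰-⊕ ⪰-refl) q

  ⪰⁺-∥ : ∀ {P′ P Q′ Q} → P′ ⪰⁺ P → Q′ ⪰⁺ Q → (P′ ∥ Q′) ⪰⁺ (P ∥ Q)
  ⪰⁺-∥ {P = P} {Q′ = Q′} p q =
    ⪰⁺-map (_∥ Q′) (λ r → ⪰-∥ r ⪰-refl) p ++ ⪰⁺-map (P ∥_) (⪰-∥ ⪰-refl) q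

  clock₁⇒⪰ : ∀ {P P′} → WF P → P —σ[ one ]→ P′ → P′ ⪰ P
  clock₁⇒⪰ w          c-𝟎         = ⪰-refl
  clock₁⇒⪰ w          c-act       = ⪰-refl
  clock₁⇒⪰ w          c-σ         = ⪰-σ
  clock₁⇒⪰ (wf-μ g w) (c-μ c)     = ⪰-μ (clock₁⇒⪰ w c) g
  clock₁⇒⪰ (wf-∖ w)   (c-∖ c)     = ⪰-∖ (clock₁⇒⪰ w c)
  clock₁⇒⪰ (wf-⟦⟧ w)  (c-⟦⟧ c)    = ⪰-⟦⟧ (clock₁⇒⪰ w c)
  clock₁⇒⪰ (wf-⊕ w v) (c-⊕ c d)   = ⪰-⊕ (clock₁⇒⪰ w c) (clock₁⇒⪰ v d)
  clock₁⇒⪰ (wf-∥ w v) (c-∥ c d _) = ⪰-∥ (clock₁⇒⪰ w c) (clock₁⇒⪰ v d)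

  clock₂⇒clock₁ : ∀ {P P′} → WF P → P —σ[ two ]→ P′ →
                  Σ Term (λ P″ → (P —σ[ one ]→ P″) × (P′ ⪰⁺ P″))
  clock₂⇒clock₁ w c-𝟎   = _ , c-𝟎 , [ ⪰-refl ]
  clock₂⇒clock₁ w c-act = _ , c-act , [ ⪰-refl ]
  clock₂⇒clock₁ w c-σ   = _ , c-σ , [ ⪰-refl ]
  clock₂⇒clock₁ (wf-μ {P} g w) (c-μ c) with clock₂⇒clock₁ w c
  ... | P₁ , c₁ , r = P₁ [ μ P /0] , c-μ c₁ , ⪰⁺-subst (sub0 (μ P)) r
  clock₂⇒clock₁ (wf-∖ {L = L} w) (c-∖ c) with clock₂⇒clock₁ w c
  ... | P₁ , c₁ , r = P₁ ∖ L , c-∖ c₁ , ⪰⁺-∖ L r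
  clock₂⇒clock₁ (wf-⟦⟧ {f = f} w) (c-⟦⟧ c) with clock₂⇒clock₁ w c
  ... | P₁ , c₁ , r = P₁ ⟦ f ⟧ , c-⟦⟧ c₁ , ⪰⁺-⟦⟧ f r
  clock₂⇒clock₁ (wf-⊕ w v) (c-⊕ c d) with clock₂⇒clock₁ w c | clock₂⇒clock₁ v d
  ... | P₁ , c₁ , r | Q₁ , d₁ , s = P₁ ⊕ Q₁ , c-⊕ c₁ d₁ , ⪰⁺-⊕ r s
  clock₂⇒clock₁ (wf-∥ w v) (c-∥ c d no-τ) with clock₂⇒clock₁ w c | clock₂⇒clock₁ v d
  ... | P₁ , c₁ , r | Q₁ , d₁ , s = P₁ ∥ Q₁ , c-∥ c₁ d₁ no-τ , ⪰⁺-∥ r s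
  clock₂⇒clock₁ (wf-σ w) (c-σσ c) with clock₂⇒clock₁ w c
  ... | P₁ , c₁ , r = _ , c-σ , r ∷ʳ clock₁⇒⪰ w c₁

proposition7 : (Λ : Set) → Λ ↣ ℕ → let open CCS Λ in
    (P P' : Term) → WF P → WF P' → P —σ[ two ]→ P' →
    Σ Term (λ P'' → WF P'' × (P —σ[ one ]→ P'') × (P' ⪰⁺ P''))
proposition7 Λ _ P P′ wP _ c₂ with clock₂⇒clock₁ wP c₂
... | P″ , c₁ , P′⪰⁺P″ = P″ , WF-clock wP c₁ , c₁ , P′⪰⁺P″
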